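{- Let $P$ be a finite thin poset. Then $P$ is diamond transitive if and only if $P$ contains no diamond-complete subposet isomorphic to a pinch product $Q_1\,\mathbin{\bowtie}\,Q_2$ of two thin posets $Q_1,Q_2$.
   Context: All posets are finite. A graded poset (rank function $\mathrm{rk}$ with $\mathrm{rk}(y)=\mathrm{rk}(x)+1$ for covers $x\lessdot y$) is thin if every nonempty closed interval of length 2 has exactly 4 elements; such an interval $\{x,a,b,y\}$ is a diamond. A saturated chain is a chain $x_0\lessdot x_1\lessdot\dots\lessdot x_k$. For a diamond $d=\{x,a,b,y\}$ and saturated chain $C$, the diamond move $dC$ replaces $a$ by $b$ if $x\lessdot a\lessdot y$ is a subchain of $C$, replaces $b$ by $a$ if $x\lessdot b\lessdot y$ is a subchain of $C$, and otherwise $dC=C$. $P$ is diamond transitive if for all $x\le y$ any two saturated chains from $x$ to $y$ are related by a finite sequence of diamond moves. Pinch product: for thin posets $P_1,P_2$ each having a unique minimum and a unique maximum and of the same rank $n\ge 3$, $P_1\mathbin{\bowtie}P_2$ is the poset obtained by removing the minimum and maximum from each, taking the disjoint union, and adjoining a new minimum $\hat 0$ and maximum $\hat 1$ (so $x\le y$ iff $x=\hat0$, or $y=\hat1$, or $x,y$ both lie in the same $P_i$ with $x\le_{P_i} y$). A subset $S\subseteq P$ with the induced order is saturated if every cover relation of $S$ is a cover relation of $P$. A saturated subset $S$ is diamond-complete if for every diamond $d$ of $P$ and every saturated chain $C$ of $S$, $dC\subseteq S$. -}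

module Defs where

open import Level using (0ℓ)
open import Data.Nat using (ℕ; suc; _∸_; _≤_)
open import Data.Fin using (Fin)
open import Data.Bool using (Bool; T; not)
open import Data.Unit using (⊤)
open import Data.Empty using (⊥)
open import Data.Product using (Σ; Σ-syntax; ∃; ∃-syntax; _×_; _,_; proj₁)
open import Data.Sum using (_⊎_)
open import Data.List using (List; []; _∷_; _++_; map)
open import Data.List.Relation.Unary.All using (All)
open import Data.List.Relation.Unary.Linked using (Linked)
open import Relation.Binary using (Rel; IsPartialOrder; Decidable)
open import Relation.Binary.PropositionalEquality using (_≡_; _≢_)
open import Relation.Binary.Construct.Closure.ReflexiveTransitive using (Star)
open import Relation.Nullary.Decidable using (isYes)
open import Data.Fin using (_≟_)
open import Function.Bundles using (_↔_; _⇔_; Inverse)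

module _ {A : Set} (_≤_ : A → A → Set) where

  Strict : A → A → Set
  Strict x y = x ≤ y × x ≢ y

  Cover : A → A → Set
  Cover x y = Strict x y × (∀ z → Strict x z → Strict z y → ⊥)

record FinPoset : Set₁ where
  field
    size           : ℕ
    _≤P_           : Rel (Fin size) 0ℓ
    isPartialOrder : IsPartialOrder _≡_ _≤P_
    _≤?_           : Decidable _≤P_

  Elt : Set
  Elt = Fin size

  _<P_ : Elt → Elt → Set
  _<P_ = Strict _≤P_

  _⋖_ : Elt → Elt → Set
  _⋖_ = Cover _≤P_

open FinPoset public

record Graded (P : FinPoset) : Set where
  field
    rk       : Elt P → ℕ
    rk-cover : ∀ {x y} → _⋖_ P x y → rk y ≡ suc (rk x)

-- Thin: every nonempty closed interval [x,y] of length 2 has exactly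
-- 4 elements, i.e. exactly two elements strictly between x and y.
ThinWrt : (P : FinPoset) → Graded P → Set
ThinWrt P g =
  ∀ x y → _≤P_ P x y → Graded.rk g y ≡ suc (suc (Graded.rk g x)) →
    Σ[ a ∈ Elt P ] Σ[ b ∈ Elt P ]
      (a ≢ b × _<P_ P x a × _<P_ P a y × _<P_ P x b × _<P_ P b y ×
       (∀ z → _<P_ P x z → _<P_ P z y → z ≡ a ⊎ z ≡ b))

IsThin : FinPoset → Set
IsThin P = Σ[ g ∈ Graded P ] ThinWrt P g

Diamond : (P : FinPoset) → Elt P → Elt P → Elt P → Elt P → Set
Diamond P x a b y =
  a ≢ b × _⋖_ P x a × _⋖_ P a y × _⋖_ P x b × _⋖_ P b y ×
  (∀ z → _<P_ P x z → _<P_ P z y → z ≡ a ⊎ z ≡ b)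

data SatChain (P : FinPoset) : Elt P → Elt P → List (Elt P) → Set where
  single : ∀ x → SatChain P x x (x ∷ [])
  step   : ∀ {x z y C} → _⋖_ P x z → SatChain P z y C → SatChain P x y (x ∷ C)

-- C' = d C for a diamond d = {x,a,b,y} with x ⋖ a ⋖ y a subchain of C
-- (nontrivial diamond moves; trivial ones dC = C are covered by Star's ε)
DiamondMove : (P : FinPoset) → List (Elt P) → List (Elt P) → Set
DiamondMove P C C' =
  Σ[ L ∈ List (Elt P) ] Σ[ R ∈ List (Elt P) ]
  Σ[ x ∈ Elt P ] Σ[ a ∈ Elt P ] Σ[ b ∈ Elt P ] Σ[ y ∈ Elt P ]
    (Diamond P x a b y ×
     C ≡ L ++ (x ∷ a ∷ y ∷ R) × C' ≡ L ++ (x ∷ b ∷ y ∷ R))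

DiamondTransitive : FinPoset → Set
DiamondTransitive P =
  ∀ x y → _≤P_ P x y → ∀ C C' → SatChain P x y C → SatChain P x y C' →
    Star (DiamondMove P) C C'

module _ (P : FinPoset) (S : Elt P → Bool) where

  SubElt : Set
  SubElt = Σ[ x ∈ Elt P ] T (S x)

  _≤S_ : SubElt → SubElt → Set
  u ≤S v = _≤P_ P (proj₁ u) (proj₁ v)

  Saturated : Set
  Saturated = ∀ u v → Cover _≤S_ u v → _⋖_ P (proj₁ u) (proj₁ v)

  DiamondComplete : Set
  DiamondComplete =
    ∀ (C : List SubElt) → Linked (Cover _≤S_) C →
      ∀ C' → DiamondMove P (map proj₁ C) C' → All (λ z → T (S z)) C'

record Bounded (Q : FinPoset) : Set where
  field
    thin  : IsThin Q
    bot   : Elt Q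
    top   : Elt Q
    isMin : ∀ x → _≤P_ Q bot x
    isMax : ∀ x → _≤P_ Q x top

  rank : ℕ
  rank = Graded.rk (proj₁ thin) top ∸ Graded.rk (proj₁ thin) bot

  interior : Elt Q → Bool
  interior q = not (isYes (q ≟ bot)) Data.Bool.∧ not (isYes (q ≟ top))

module _ {Q₁ Q₂ : FinPoset} (B₁ : Bounded Q₁) (B₂ : Bounded Q₂) where

  data PinchElt : Set where
    pbot : PinchElt
    ptop : PinchElt
    inl  : (q : Elt Q₁) → T (Bounded.interior B₁ q) → PinchElt
    inr  : (q : Elt Q₂) → T (Bounded.interior B₂ q) → PinchElt

  _≤⋈_ : PinchElt → PinchElt → Set
  pbot ≤⋈ _ = ⊤
  _ ≤⋈ ptop = ⊤
  inl p _ ≤⋈ inl q _ = _≤P_ Q₁ p q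
  inr p _ ≤⋈ inr q _ = _≤P_ Q₂ p q
  _ ≤⋈ _ = ⊥

OrderIso : {A B : Set} → (A → A → Set) → (B → B → Set) → Set
OrderIso {A} {B} _≤A_ _≤B_ =
  Σ[ φ ∈ A ↔ B ] (∀ u v → (u ≤A v) ⇔ (Inverse.to φ u ≤B Inverse.to φ v))

ContainsPinch : FinPoset → Set₁
ContainsPinch P =
  Σ[ Q₁ ∈ FinPoset ] Σ[ Q₂ ∈ FinPoset ]
  Σ[ B₁ ∈ Bounded Q₁ ] Σ[ B₂ ∈ Bounded Q₂ ]
  Σ[ n ∈ ℕ ]
    (Bounded.rank B₁ ≡ n × Bounded.rank B₂ ≡ n × 3 ≤ n ×
     Σ[ S ∈ (Elt P → Bool) ]
       (Saturated P S × DiamondComplete P S ×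
        OrderIso (_≤S_ P S) (_≤⋈_ B₁ B₂)))

module Submission where

-- (⇒) If S ⊆ P is a diamond-complete copy of Q₁ ⋈ Q₂ with bottom X and top Y,
-- a maximal chain of Q₁ and one of Q₂ give saturated chains X ⋖ … ⋖ Y of P
-- through the left and the right side.  Since the rank is at least 3, a
-- diamond move on a chain lying on the left replaces a middle element by an
-- element of S (diamond completeness) comparable to left elements or to both
-- X and Y, hence again on the left; so the two chains are not connected.
--
-- (⇐) By induction on the length of two saturated chains x ⋖ a ⋖ … ⋖ y and
-- x ⋖ a' ⋖ … ⋖ y.  If a and a' are connected in the atom graph of [x , y]
-- (atoms adjacent when they lie in a common diamond below y) we cross one
-- diamond at a time, using the induction hypothesis on the shorter chains
-- above the atoms.  Otherwise x, y and the parts of (x , y) above the two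
-- components of a and a' form a diamond-complete pinch.

open import Defs
open import Data.Nat using (ℕ; zero; suc; _+_; _∸_; _≤_; _<_; s≤s)
open import Data.Nat.Properties
  using (≤-refl; ≤-trans; ≤-pred; ≤-antisym; ≤-reflexive; ≰⇒>; n≤1+n; 1+n≰n; <-irrefl; +-suc; +-comm;
         +-cancelˡ-≡; +-cancelˡ-≤; +-cancelˡ-<; +-monoʳ-≤; +-monoˡ-≤; m∸n+n≡m; m+n≤o⇒m≤o∸n)
open import Data.Fin using (Fin; zero; suc; _≟_)
open import Data.Fin.Properties using (all?; any?; suc-injective)
open import Data.Fin.Induction using (po-wellFounded; po-noetherian)
open import Data.Bool using (Bool; true; false; T; not; _∧_)
open import Data.Bool.Properties using (T-irrelevant)
open import Data.Unit using (⊤; tt)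
open import Data.Empty using (⊥; ⊥-elim)
open import Data.Product using (Σ-syntax; _×_; _,_; proj₁; proj₂)
open import Data.Sum using (_⊎_; inj₁; inj₂)
import Data.Sum
open import Data.List using (List; []; _∷_; _++_; map; length; allFin)
open import Data.List.Membership.Propositional using (_∈_)
open import Data.List.Membership.Propositional.Properties using (∈-allFin)
open import Data.List.Relation.Unary.Any using (here; there)
open import Data.List.Relation.Unary.All using (All; []; _∷_; universal)
import Data.List.Relation.Unary.All as All
open import Data.List.Relation.Unary.All.Properties using (++⁻; ++⁻ʳ; ++⁺; map⁺)
open import Data.List.Relation.Unary.Linked using (Linked; [-]; _∷_)
open import Function using (_∘_; flip; id)
open import Function.Bundles using (_⇔_; mk⇔; _↔_; Inverse; mk↔ₛ′; Equivalence)
open import Function.Construct.Composition using (_↔-∘_; _⇔-∘_)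
open import Induction.WellFounded using (Acc; acc)
open import Relation.Binary.Structures using (IsPartialOrder)
import Relation.Binary.Construct.NonStrictToStrict
open import Relation.Binary.PropositionalEquality
  using (_≡_; _≢_; refl; sym; trans; cong; cong₂; subst; subst₂; resp₂; isEquivalence; module ≡-Reasoning)
open import Relation.Binary.Construct.Closure.ReflexiveTransitive using (Star; ε; _◅_; _◅◅_; gmap; reverse)
open import Relation.Nullary using (¬_; Dec; yes; no; ¬?)
open import Relation.Nullary.Decidable using (_×-dec_; _⊎-dec_; _→-dec_; map′; isYes; toWitness; fromWitness)

module FinitePoset (Q : FinPoset) where
  open FinPoset Q public using ()
    renaming (_≤P_ to _⊑_; _<P_ to _⊏_; _⋖_ to _≺_; _≤?_ to _⊑?_)
  open IsPartialOrder (isPartialOrder Q) public using ()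
    renaming (refl to ⊑-refl; trans to ⊑-trans; antisym to ⊑-antisym; reflexive to ⊑-reflexive)
  private module Strict = Relation.Binary.Construct.NonStrictToStrict _≡_ _⊑_

  ⊏-irrefl : ∀ {x} → x ⊏ x → ⊥
  ⊏-irrefl = Strict.<-irrefl refl

  ⊏-trans : ∀ {x y z} → x ⊏ y → y ⊏ z → x ⊏ z
  ⊏-trans = Strict.<-trans (isPartialOrder Q)

  ⊏-⊑-trans : ∀ {x y z} → x ⊏ y → y ⊑ z → x ⊏ z
  ⊏-⊑-trans = Strict.<-≤-trans sym ⊑-trans ⊑-antisym (proj₁ (resp₂ _⊑_))

  ⊑-⊏-trans : ∀ {x y z} → x ⊑ y → y ⊏ z → x ⊏ z
  ⊑-⊏-trans = Strict.≤-<-trans ⊑-trans ⊑-antisym (proj₂ (resp₂ _⊑_))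

  ⊏-asym : ∀ {x y} → x ⊏ y → y ⊏ x → ⊥
  ⊏-asym = Strict.<-asym ⊑-antisym

  _⊏?_ : ∀ x y → Dec (x ⊏ y)
  _⊏?_ = Strict.<-decidable _≟_ _⊑?_

  _≺?_ : ∀ x y → Dec (x ≺ y)
  x ≺? y = (x ⊏? y) ×-dec all? (λ z → (x ⊏? z) →-dec ((z ⊏? y) →-dec no (λ ())))

  ≺⇒⊏ : ∀ {x y} → x ≺ y → x ⊏ y
  ≺⇒⊏ = proj₁

  ≺⇒⊑ : ∀ {x y} → x ≺ y → x ⊑ y
  ≺⇒⊑ = proj₁ ∘ proj₁

  coverBelow : ∀ {x y} → x ⊏ y → Σ[ z ∈ Elt Q ] (x ≺ z × z ⊑ y)
  coverBelow {x} {y} = go (po-wellFounded (isPartialOrder Q) y)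
    where
    go : ∀ {y} → Acc _⊏_ y → x ⊏ y → Σ[ z ∈ Elt Q ] (x ≺ z × z ⊑ y)
    go {y} (acc below) x⊏y with any? (λ w → (x ⊏? w) ×-dec (w ⊏? y))
    ... | no nothingBetween = y , (x⊏y , λ w x⊏w w⊏y → nothingBetween (w , x⊏w , w⊏y)) , ⊑-refl
    ... | yes (w , x⊏w , w⊏y) =
      let (z , x≺z , z⊑w) = go (below w⊏y) x⊏w in z , x≺z , ⊑-trans z⊑w (proj₁ w⊏y)

  satChainExists : ∀ {x y} → x ⊑ y → Σ[ C ∈ List (Elt Q) ] SatChain Q x y C
  satChainExists {x} {y} = go (po-noetherian (isPartialOrder Q) x)
    where
    go : ∀ {x} → Acc (flip _⊏_) x → x ⊑ y → Σ[ C ∈ List (Elt Q) ] SatChain Q x y C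
    go {x} (acc above) x⊑y with x ≟ y
    ... | yes refl = _ , single x
    ... | no x≢y =
      let (z , x≺z , z⊑y) = coverBelow (x⊑y , x≢y)
          (C , chain) = go (above (≺⇒⊏ x≺z)) z⊑y
      in _ , step x≺z chain

  satChain⇒⊑ : ∀ {x y C} → SatChain Q x y C → x ⊑ y
  satChain⇒⊑ (single x) = ⊑-refl
  satChain⇒⊑ (step c chain) = ⊑-trans (≺⇒⊑ c) (satChain⇒⊑ chain)

  satChainHead : ∀ {x y w C} → SatChain Q x y (w ∷ C) → x ≡ w
  satChainHead (single x) = refl
  satChainHead (step c chain) = refl

  satChainShape : ∀ {x y C} → SatChain Q x y C → Σ[ C' ∈ List (Elt Q) ] C ≡ x ∷ C'
  satChainShape (single x) = [] , refl
  satChainShape (step c chain) = _ , refl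

  noReturn : ∀ {x z C} → x ≺ z → SatChain Q z x C → ⊥
  noReturn x≺z chain = ⊏-irrefl (⊏-⊑-trans (≺⇒⊏ x≺z) (satChain⇒⊑ chain))

  satChainLoop : ∀ {x C} → SatChain Q x x C → length C ≡ 1
  satChainLoop (single _) = refl
  satChainLoop (step c chain) = ⊥-elim (noReturn c chain)

  module Ranks (g : Graded Q) where
    rk : Elt Q → ℕ
    rk = Graded.rk g

    rankChain : ∀ {x y C} → SatChain Q x y C → rk x + length C ≡ suc (rk y)
    rankChain {x} (single x) = +-comm (rk x) 1
    rankChain {x} {y} (step {z = z} {C = C} c chain) = begin
      rk x + suc (length C)    ≡⟨ +-suc (rk x) (length C) ⟩
      suc (rk x) + length C    ≡⟨ cong (_+ length C) (sym (Graded.rk-cover g c)) ⟩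
      rk z + length C          ≡⟨ rankChain chain ⟩
      suc (rk y)               ∎
      where open ≡-Reasoning

    rk-mono : ∀ {x y} → x ⊑ y → rk x ≤ rk y
    rk-mono = chainRank ∘ proj₂ ∘ satChainExists
      where
      chainRank : ∀ {x y C} → SatChain Q x y C → rk x ≤ rk y
      chainRank (single _) = ≤-refl
      chainRank {y = y} (step c chain) =
        ≤-trans (n≤1+n _) (subst (_≤ rk y) (Graded.rk-cover g c) (chainRank chain))

    rk-strict : ∀ {x y} → x ⊏ y → rk x < rk y
    rk-strict {y = y} x⊏y with coverBelow x⊏y
    ... | z , x≺z , z⊑y = subst (_≤ rk y) (Graded.rk-cover g x≺z) (rk-mono z⊑y)

    chainLengthUnique : ∀ {x y C D} → SatChain Q x y C → SatChain Q x y D → length C ≡ length D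
    chainLengthUnique {x} c d = +-cancelˡ-≡ (rk x) _ _ (trans (rankChain c) (sym (rankChain d)))

    rankOfTwoCovers : ∀ {x b y} → x ≺ b → b ≺ y → rk y ≡ suc (suc (rk x))
    rankOfTwoCovers x≺b b≺y = trans (Graded.rk-cover g b≺y) (cong suc (Graded.rk-cover g x≺b))

    sameRank⇒≡ : ∀ {x y} → x ⊑ y → rk x ≡ rk y → x ≡ y
    sameRank⇒≡ {x} {y} x⊑y e with x ≟ y
    ... | yes x≡y = x≡y
    ... | no x≢y = ⊥-elim (<-irrefl e (rk-strict (x⊑y , x≢y)))

    coverByRank : ∀ {x y} → x ⊏ y → rk y ≡ suc (rk x) → x ≺ y
    coverByRank {x} {y} x⊏y e = x⊏y , λ z x⊏z z⊏y →
      <-irrefl refl (≤-trans (subst (suc (rk z) ≤_) e (rk-strict z⊏y)) (rk-strict x⊏z))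

-- The members of a Boolean predicate p on Fin n, enumerated by Fin (count p):
-- `member p` embeds Fin (count p) into Fin n and `indexOf p` is its inverse on
-- the members.  This is how a subset of a finite poset becomes a FinPoset.
module Enumeration where
  addIf : Bool → ℕ → ℕ
  addIf true k = suc k
  addIf false k = k

  count : ∀ {n} → (Fin n → Bool) → ℕ
  count {zero} p = 0
  count {suc n} p = addIf (p zero) (count (p ∘ suc))

  private
    memberStep : ∀ {n k} (b : Bool) → (Fin k → Fin n) → Fin (addIf b k) → Fin (suc n)
    memberStep true m zero = zero
    memberStep true m (suc j) = suc (m j)
    memberStep false m j = suc (m j)

    indexZero : ∀ {k} (b : Bool) → T b → Fin (addIf b k)
    indexZero true _ = zero

    indexSuc : ∀ {k} (b : Bool) → Fin k → Fin (addIf b k)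
    indexSuc true j = suc j
    indexSuc false j = j

  member : ∀ {n} (p : Fin n → Bool) → Fin (count p) → Fin n
  member {suc n} p = memberStep (p zero) (member (p ∘ suc))

  indexOf : ∀ {n} (p : Fin n → Bool) (i : Fin n) → T (p i) → Fin (count p)
  indexOf {suc n} p zero t = indexZero (p zero) t
  indexOf {suc n} p (suc i) t = indexSuc (p zero) (indexOf (p ∘ suc) i t)

  member-in : ∀ {n} (p : Fin n → Bool) (j : Fin (count p)) → T (p (member p j))
  member-in {suc n} p = go (p zero) refl (member (p ∘ suc)) (member-in (p ∘ suc))
    where
    go : ∀ {k} (b : Bool) → p zero ≡ b → (m : Fin k → Fin n) → (∀ j → T (p (suc (m j)))) →
         ∀ j → T (p (memberStep b m j))
    go true e m h zero rewrite e = tt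
    go true e m h (suc j) = h j
    go false e m h j = h j

  member-indexOf : ∀ {n} (p : Fin n → Bool) i t → member p (indexOf p i t) ≡ i
  member-indexOf {suc n} p zero t = go (p zero) t
    where
    go : (b : Bool) (t : T b) → memberStep b (member (p ∘ suc)) (indexZero b t) ≡ zero
    go true _ = refl
  member-indexOf {suc n} p (suc i) t =
    trans (go (p zero) (indexOf (p ∘ suc) i t)) (cong suc (member-indexOf (p ∘ suc) i t))
    where
    go : (b : Bool) (j : Fin (count (p ∘ suc))) →
         memberStep b (member (p ∘ suc)) (indexSuc b j) ≡ suc (member (p ∘ suc) j)
    go true j = refl
    go false j = refl

  member-injective : ∀ {n} (p : Fin n → Bool) {j j'} → member p j ≡ member p j' → j ≡ j'
  member-injective {suc n} p = go (p zero) (member (p ∘ suc)) (member-injective (p ∘ suc))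
    where
    go : ∀ {k} (b : Bool) (m : Fin k → Fin n) → (∀ {j j'} → m j ≡ m j' → j ≡ j') →
         ∀ {j j'} → memberStep b m j ≡ memberStep b m j' → j ≡ j'
    go true m inj {zero} {zero} e = refl
    go true m inj {suc j} {suc j'} e = cong suc (inj (suc-injective e))
    go false m inj e = inj (suc-injective e)

  indexOf-member : ∀ {n} (p : Fin n → Bool) j t → indexOf p (member p j) t ≡ j
  indexOf-member p j t = member-injective p (member-indexOf p (member p j) t)

-- Reachability in a finite graph with decidable edges is decidable.  Paths are
-- classified by the set U of allowed intermediate vertices (Floyd–Warshall).
module Reachability {n : ℕ} (E : Fin n → Fin n → Set) (E? : ∀ a b → Dec (E a b)) where
  private
    data PathVia (U : List (Fin n)) : Fin n → Fin n → Set where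
      done : ∀ {a} → PathVia U a a
      edge : ∀ {a b} → E a b → PathVia U a b
      via  : ∀ {a m b} → m ∈ U → PathVia U a m → PathVia U m b → PathVia U a b

    widen : ∀ {u U a b} → PathVia U a b → PathVia (u ∷ U) a b
    widen done = done
    widen (edge e) = edge e
    widen (via m p q) = via (there m) (widen p) (widen q)

    split : ∀ {u U a b} → PathVia (u ∷ U) a b → PathVia U a b ⊎ (PathVia U a u × PathVia U u b)
    split done = inj₁ done
    split (edge e) = inj₁ (edge e)
    split (via (here refl) p q) with split p | split q
    ... | inj₁ p' | inj₁ q' = inj₂ (p' , q')
    ... | inj₁ p' | inj₂ (_ , q') = inj₂ (p' , q')
    ... | inj₂ (p' , _) | inj₁ q' = inj₂ (p' , q')
    ... | inj₂ (p' , _) | inj₂ (_ , q') = inj₂ (p' , q')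
    split (via (there m) p q) with split p | split q
    ... | inj₁ p' | inj₁ q' = inj₁ (via m p' q')
    ... | inj₁ p' | inj₂ (q₁ , q₂) = inj₂ (via m p' q₁ , q₂)
    ... | inj₂ (p₁ , p₂) | inj₁ q' = inj₂ (p₁ , via m p₂ q')
    ... | inj₂ (p₁ , _) | inj₂ (_ , q₂) = inj₂ (p₁ , q₂)

    pathVia? : ∀ U a b → Dec (PathVia U a b)
    pathVia? [] a b = map′ (λ { (inj₁ refl) → done ; (inj₂ e) → edge e })
                           (λ { done → inj₁ refl ; (edge e) → inj₂ e ; (via () _ _) })
                           ((a ≟ b) ⊎-dec E? a b)
    pathVia? (u ∷ U) a b =
      map′ (λ { (inj₁ p) → widen p ; (inj₂ (p , q)) → via (here refl) (widen p) (widen q) })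
           split
           (pathVia? U a b ⊎-dec (pathVia? U a u ×-dec pathVia? U u b))

    toStar : ∀ {U a b} → PathVia U a b → Star E a b
    toStar done = ε
    toStar (edge e) = e ◅ ε
    toStar (via _ p q) = toStar p ◅◅ toStar q

    fromStar : ∀ {a b} → Star E a b → PathVia (allFin n) a b
    fromStar ε = done
    fromStar (e ◅ s) = via (∈-allFin _) (edge e) (fromStar s)

  reachable? : ∀ a b → Dec (Star E a b)
  reachable? a b = map′ toStar fromStar (pathVia? (allFin n) a b)

interior⇔ : ∀ {Q} (B : Bounded Q) (q : Elt Q) →
  T (Bounded.interior B q) ⇔ (q ≢ Bounded.bot B × q ≢ Bounded.top B)
interior⇔ B q = mk⇔ (from (q ≟ Bounded.bot B) (q ≟ Bounded.top B))
                    (to (q ≟ Bounded.bot B) (q ≟ Bounded.top B))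
  where
  from : ∀ {b t} (d : Dec (q ≡ b)) (d' : Dec (q ≡ t)) →
         T (not (isYes d) ∧ not (isYes d')) → q ≢ b × q ≢ t
  from (no q≢b) (no q≢t) _ = q≢b , q≢t
  to : ∀ {b t} (d : Dec (q ≡ b)) (d' : Dec (q ≡ t)) →
       q ≢ b × q ≢ t → T (not (isYes d) ∧ not (isYes d'))
  to (yes q≡b) _ (q≢b , _) = q≢b q≡b
  to (no _) (yes q≡t) (_ , q≢t) = q≢t q≡t
  to (no _) (no _) _ = tt

maximalChainLong : ∀ {Q} (B : Bounded Q) {C} → 3 ≤ Bounded.rank B →
                   SatChain Q (Bounded.bot B) (Bounded.top B) C → 4 ≤ length C
maximalChainLong {Q} B {C} long chain =
  +-cancelˡ-≤ (rk bot) 4 (length C) (subst (rk bot + 4 ≤_) (sym (rankChain chain)) bound)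
  where
  open Bounded B using (bot; top)
  open FinitePoset.Ranks Q (proj₁ (Bounded.thin B))
  bound : rk bot + 4 ≤ suc (rk top)
  bound = subst (_≤ suc (rk top)) (+-comm 4 (rk bot))
            (s≤s (subst (3 + rk bot ≤_) (m∸n+n≡m (rk-mono (Bounded.isMin B top)))
                        (+-monoˡ-≤ (rk bot) long)))

module InducedSubposet (P : FinPoset) (p : Elt P → Bool) where
  open FinitePoset P
  open Enumeration

  ι : Fin (count p) → Elt P
  ι = member p

  sub : FinPoset
  sub = record
    { size = count p
    ; _≤P_ = λ u v → ι u ⊑ ι v
    ; isPartialOrder = record
      { isPreorder = record
        { isEquivalence = isEquivalence
        ; reflexive = λ { refl → ⊑-refl }
        ; trans = ⊑-trans }
      ; antisym = λ u⊑v v⊑u → member-injective p (⊑-antisym u⊑v v⊑u) }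
    ; _≤?_ = λ u v → ι u ⊑? ι v }

  ι-in : ∀ u → T (p (ι u))
  ι-in = member-in p

  ι-strict : ∀ {u v} → _<P_ sub u v → ι u ⊏ ι v
  ι-strict (u⊑v , u≢v) = u⊑v , u≢v ∘ member-injective p

  ι-strict⁻ : ∀ {u v} → ι u ⊏ ι v → _<P_ sub u v
  ι-strict⁻ (u⊑v , u≢v) = u⊑v , u≢v ∘ cong ι

  index : ∀ m → T (p m) → Elt sub
  index = indexOf p

  ι-index : ∀ m t → ι (index m t) ≡ m
  ι-index = member-indexOf p

  ι≡⇒≡index : ∀ {z m} → ι z ≡ m → (t : T (p m)) → z ≡ index m t
  ι≡⇒≡index {z} refl t = sym (indexOf-member p z t)

  index-strictˡ : ∀ {m w} t → m ⊏ ι w → _<P_ sub (index m t) w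
  index-strictˡ {m} t m⊏w = ι-strict⁻ (subst (_⊏ _) (sym (ι-index m t)) m⊏w)

  index-strictʳ : ∀ {m w} t → ι w ⊏ m → _<P_ sub w (index m t)
  index-strictʳ {m} t w⊏m = ι-strict⁻ (subst (_ ⊏_) (sym (ι-index m t)) w⊏m)

  coverGap : ∀ {u v} → _⋖_ sub u v → ∀ m → T (p m) → ι u ⊏ m → m ⊏ ι v → ⊥
  coverGap (_ , gap) m t u⊏m m⊏v = gap (index m t) (index-strictʳ t u⊏m) (index-strictˡ t m⊏v)

  module Bounding (g : Graded P) (thinP : ThinWrt P g)
    (saturated : ∀ {z w} → T (p z) → T (p w) → z ⊏ w →
                 (∀ m → T (p m) → z ⊏ m → m ⊏ w → ⊥) → z ≺ w)
    (closed₂ : ∀ {z w m} → T (p z) → T (p w) → z ⊏ m → m ⊏ w →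
               Graded.rk g w ≡ suc (suc (Graded.rk g z)) → T (p m))
    (bot top : Elt P) (bot∈ : T (p bot)) (top∈ : T (p top))
    (bot≤ : ∀ z → T (p z) → bot ⊑ z) (≤top : ∀ z → T (p z) → z ⊑ top) where
    open Ranks g

    ι-cover : ∀ {u v} → _⋖_ sub u v → ι u ≺ ι v
    ι-cover {u} {v} c = saturated (ι-in u) (ι-in v) (ι-strict (proj₁ c)) (coverGap c)

    subGraded : Graded sub
    subGraded = record { rk = rk ∘ ι ; rk-cover = Graded.rk-cover g ∘ ι-cover }

    subThin : ThinWrt sub subGraded
    subThin u v u⊑v e with thinP (ι u) (ι v) u⊑v e
    ... | m₁ , m₂ , m₁≢m₂ , u⊏m₁ , m₁⊏v , u⊏m₂ , m₂⊏v , onlyTwo =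
      index m₁ t₁ , index m₂ t₂ ,
      (λ q → m₁≢m₂ (trans (sym (ι-index m₁ t₁)) (trans (cong ι q) (ι-index m₂ t₂)))) ,
      index-strictʳ t₁ u⊏m₁ , index-strictˡ t₁ m₁⊏v ,
      index-strictʳ t₂ u⊏m₂ , index-strictˡ t₂ m₂⊏v ,
      λ z u⊏z z⊏v → Data.Sum.map (λ q → ι≡⇒≡index q t₁) (λ q → ι≡⇒≡index q t₂)
                                 (onlyTwo (ι z) (ι-strict u⊏z) (ι-strict z⊏v))
      where
      t₁ : T (p m₁)
      t₁ = closed₂ (ι-in u) (ι-in v) u⊏m₁ m₁⊏v e
      t₂ : T (p m₂)
      t₂ = closed₂ (ι-in u) (ι-in v) u⊏m₂ m₂⊏v e

    bounded : Bounded sub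
    bounded = record
      { thin = subGraded , subThin
      ; bot = index bot bot∈
      ; top = index top top∈
      ; isMin = λ q → subst (_⊑ ι q) (sym (ι-index bot bot∈)) (bot≤ (ι q) (ι-in q))
      ; isMax = λ q → subst (ι q ⊑_) (sym (ι-index top top∈)) (≤top (ι q) (ι-in q)) }

    boundedRank : Bounded.rank bounded ≡ rk top ∸ rk bot
    boundedRank = cong₂ _∸_ (cong rk (ι-index top top∈)) (cong rk (ι-index bot bot∈))

-- three-element bookkeeping behind "the two middle elements of a thin interval"
twoElements : ∀ {A : Set} {m₁ m₂ a b z : A} → a ≢ b →
  a ≡ m₁ ⊎ a ≡ m₂ → b ≡ m₁ ⊎ b ≡ m₂ → z ≡ m₁ ⊎ z ≡ m₂ → z ≡ a ⊎ z ≡ b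
twoElements a≢b (inj₁ refl) (inj₁ refl) _ = ⊥-elim (a≢b refl)
twoElements a≢b (inj₁ refl) (inj₂ refl) (inj₁ refl) = inj₁ refl
twoElements a≢b (inj₁ refl) (inj₂ refl) (inj₂ refl) = inj₂ refl
twoElements a≢b (inj₂ refl) (inj₁ refl) (inj₁ refl) = inj₂ refl
twoElements a≢b (inj₂ refl) (inj₁ refl) (inj₂ refl) = inj₁ refl
twoElements a≢b (inj₂ refl) (inj₂ refl) _ = ⊥-elim (a≢b refl)

module ThinPoset (P : FinPoset) (thin : IsThin P) where
  open FinitePoset P public
  open Ranks (proj₁ thin) public

  Move : List (Elt P) → List (Elt P) → Set
  Move = DiamondMove P

  diamondSym : ∀ {x a b y} → Diamond P x a b y → Diamond P x b a y
  diamondSym (a≢b , xa , ay , xb , by , onlyTwo) =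
    a≢b ∘ sym , xb , by , xa , ay , λ z x⊏z z⊏y → Data.Sum.swap (onlyTwo z x⊏z z⊏y)

  diamond? : ∀ x a b y → Dec (Diamond P x a b y)
  diamond? x a b y =
    ¬? (a ≟ b) ×-dec (x ≺? a) ×-dec (a ≺? y) ×-dec (x ≺? b) ×-dec (b ≺? y) ×-dec
    all? (λ z → (x ⊏? z) →-dec ((z ⊏? y) →-dec ((z ≟ a) ⊎-dec (z ≟ b))))

  diamondOfCovers : ∀ {x a b w} → a ≢ b → x ≺ a → x ≺ b → a ≺ w → b ≺ w → Diamond P x a b w
  diamondOfCovers {x} {a} {b} {w} a≢b xa xb aw bw
    with proj₂ thin x w (⊑-trans (≺⇒⊑ xa) (≺⇒⊑ aw)) (rankOfTwoCovers xa aw)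
  ... | _ , _ , _ , _ , _ , _ , _ , onlyTwo =
    a≢b , xa , aw , xb , bw , λ z x⊏z z⊏w →
      twoElements a≢b (onlyTwo a (≺⇒⊏ xa) (≺⇒⊏ aw)) (onlyTwo b (≺⇒⊏ xb) (≺⇒⊏ bw))
                      (onlyTwo z x⊏z z⊏w)

  moveSatChain : ∀ {s t C C'} → SatChain P s t C → Move C C' → SatChain P s t C'
  moveSatChain chain (L , R , x , a , b , y , d , refl , refl) = go L chain d
    where
    go : ∀ {s t} L {x a b y R} → SatChain P s t (L ++ x ∷ a ∷ y ∷ R) → Diamond P x a b y →
         SatChain P s t (L ++ x ∷ b ∷ y ∷ R)
    go [] (step _ (step _ rest)) (_ , _ , _ , xb , by , _) =
      step xb (step (subst (_ ≺_) (sym (satChainHead rest)) by) rest)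
    go (l ∷ []) (step c chain) d = step c (go [] chain d)
    go (l ∷ l' ∷ L) (step c chain) d = step c (go (l' ∷ L) chain d)

  movesSatChain : ∀ {s t C C'} → SatChain P s t C → Star Move C C' → SatChain P s t C'
  movesSatChain chain ε = chain
  movesSatChain chain (m ◅ ms) = movesSatChain (moveSatChain chain m) ms

  consMoves : ∀ z {C C'} → Star Move C C' → Star Move (z ∷ C) (z ∷ C')
  consMoves z = gmap (z ∷_) λ { (L , R , x , a , b , y , d , e , e') →
    z ∷ L , R , x , a , b , y , d , cong (z ∷_) e , cong (z ∷_) e' }

  module AtomGraph (x y : Elt P) where
    Adjacent : Elt P → Elt P → Set
    Adjacent b c = Σ[ w ∈ Elt P ] (Diamond P x b c w × w ⊑ y)

    Connected : Elt P → Elt P → Set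
    Connected = Star Adjacent

    connected? : ∀ b c → Dec (Connected b c)
    connected? = Reachability.reachable? Adjacent (λ b c → any? (λ w → diamond? x b c w ×-dec (w ⊑? y)))

    connectedSym : ∀ {b c} → Connected b c → Connected c b
    connectedSym = reverse λ { (w , d , w⊑y) → w , diamondSym d , w⊑y }

    moveAtom : ∀ {z C D b C'} → z ⊑ y → SatChain P x z C → Move C D → C ≡ x ∷ b ∷ C' →
               Σ[ c ∈ Elt P ] Σ[ D' ∈ List (Elt P) ] (D ≡ x ∷ c ∷ D' × (b ≡ c ⊎ Adjacent b c))
    moveAtom z⊑y (step _ (step _ rest)) ([] , R , _ , _ , b' , y' , d , refl , refl) refl =
      b' , _ , refl ,
      inj₂ (y' , d , ⊑-trans (⊑-reflexive (sym (satChainHead rest))) (⊑-trans (satChain⇒⊑ rest) z⊑y))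
    moveAtom z⊑y chain (l ∷ [] , R , _ , _ , _ , _ , _ , e , refl) e' with trans (sym e) e'
    ... | refl = _ , _ , refl , inj₁ refl
    moveAtom z⊑y chain (l ∷ l' ∷ L , R , _ , _ , _ , _ , _ , e , refl) e' with trans (sym e) e'
    ... | refl = _ , _ , refl , inj₁ refl

    movesConnectAtoms : ∀ {z C D b c C' D'} → z ⊑ y → SatChain P x z C → Star Move C D →
                        C ≡ x ∷ b ∷ C' → D ≡ x ∷ c ∷ D' → Connected b c
    movesConnectAtoms z⊑y chain ε refl refl = ε
    movesConnectAtoms z⊑y chain (m ◅ ms) e e' with moveAtom z⊑y chain m e
    ... | _ , _ , e'' , inj₁ refl = movesConnectAtoms z⊑y (moveSatChain chain m) ms e'' e'
    ... | _ , _ , e'' , inj₂ adj = adj ◅ movesConnectAtoms z⊑y (moveSatChain chain m) ms e'' e'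

module PinchOfDisconnectedAtoms (P : FinPoset) (thin : IsThin P) (x y a a' : Elt P)
  (x≺a : _⋖_ P x a) (x≺a' : _⋖_ P x a') (a⊑y : _≤P_ P a y) (a'⊑y : _≤P_ P a' y)
  (disconnected : ¬ ThinPoset.AtomGraph.Connected P thin x y a a')
  (transitiveBelow : ∀ {z C D} → _<P_ P z y → SatChain P x z C → SatChain P x z D →
                     Star (DiamondMove P) C D) where
  open ThinPoset P thin
  open AtomGraph x y

  atomsBelowConnected : ∀ {z b c} → z ⊏ y → x ≺ b → x ≺ c → b ⊑ z → c ⊑ z → Connected b c
  atomsBelowConnected z⊏y x≺b x≺c b⊑z c⊑z with satChainExists b⊑z | satChainExists c⊑z
  ... | _ , chainB | _ , chainC =
    movesConnectAtoms (proj₁ z⊏y) (step x≺b chainB)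
      (transitiveBelow z⊏y (step x≺b chainB) (step x≺c chainC))
      (cong (x ∷_) (proj₂ (satChainShape chainB))) (cong (x ∷_) (proj₂ (satChainShape chainC)))

  rk-a : rk a ≡ suc (rk x)
  rk-a = Graded.rk-cover (proj₁ thin) x≺a

  rk-a' : rk a' ≡ suc (rk x)
  rk-a' = Graded.rk-cover (proj₁ thin) x≺a'

  a≢a' : a ≢ a'
  a≢a' refl = disconnected ε

  -- neither atom is y: the other atom, of the same rank, would lie below it
  a⊏y : a ⊏ y
  a⊏y = a⊑y , λ { refl → a≢a' (sym (sameRank⇒≡ a'⊑y (trans rk-a' (sym rk-a)))) }

  a'⊏y : a' ⊏ y
  a'⊏y = a'⊑y , λ { refl → a≢a' (sameRank⇒≡ a⊑y (trans rk-a (sym rk-a'))) }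

  x⊏y : x ⊏ y
  x⊏y = ⊏-trans (≺⇒⊏ x≺a) a⊏y

  -- [x , y] has length at least 3, for otherwise {x , a , a' , y} is a diamond
  notShort : rk y ≤ suc (suc (rk x)) → ⊥
  notShort short =
    disconnected
      ((y , diamondOfCovers a≢a' x≺a x≺a' (coverOfY a⊏y rk-a) (coverOfY a'⊏y rk-a') , ⊑-refl) ◅ ε)
    where
    rk-y : rk y ≡ suc (suc (rk x))
    rk-y = ≤-antisym short (subst (_< rk y) rk-a (rk-strict a⊏y))
    coverOfY : ∀ {t} → t ⊏ y → rk t ≡ suc (rk x) → t ≺ y
    coverOfY t⊏y e = coverByRank t⊏y (trans rk-y (cong suc (sym e)))

  length≥3 : 3 ≤ rk y ∸ rk x
  length≥3 = m+n≤o⇒m≤o∸n 3 (≰⇒> notShort)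

  notWhole : ∀ {z w} → rk w ≡ suc (suc (rk z)) → ¬ (z ≡ x × w ≡ y)
  notWhole e (refl , refl) = notShort (≤-reflexive e)

  Above : Elt P → Elt P → Set
  Above t z = x ⊏ z × z ⊏ y × Σ[ b ∈ Elt P ] (x ≺ b × b ⊑ z × Connected b t)

  above? : ∀ t z → Dec (Above t z)
  above? t z = (x ⊏? z) ×-dec (z ⊏? y) ×-dec any? (λ b → (x ≺? b) ×-dec (b ⊑? z) ×-dec connected? b t)

  x⊏above : ∀ {t z} → Above t z → x ⊏ z
  x⊏above = proj₁

  above⊏y : ∀ {t z} → Above t z → z ⊏ y
  above⊏y = proj₁ ∘ proj₂

  x≢above : ∀ {t z} → Above t z → z ≢ x
  x≢above i refl = ⊏-irrefl (x⊏above i)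

  y≢above : ∀ {t z} → Above t z → z ≢ y
  y≢above i refl = ⊏-irrefl (above⊏y i)

  aboveUp : ∀ {t z w} → Above t z → z ⊑ w → w ⊏ y → Above t w
  aboveUp (x⊏z , _ , b , x≺b , b⊑z , conn) z⊑w w⊏y =
    ⊏-⊑-trans x⊏z z⊑w , w⊏y , b , x≺b , ⊑-trans b⊑z z⊑w , conn

  -- going down stays in the component since atoms below z ⊏ y are connected
  aboveDown : ∀ {t z w} → Above t z → x ⊏ w → w ⊑ z → Above t w
  aboveDown (x⊏z , z⊏y , b , x≺b , b⊑z , conn) x⊏w w⊑z with coverBelow x⊏w
  ... | c , x≺c , c⊑w =
    x⊏w , ⊑-⊏-trans w⊑z z⊏y , c , x≺c , c⊑w ,
    (atomsBelowConnected z⊏y x≺c x≺b (⊑-trans c⊑w w⊑z) b⊑z ◅◅ conn)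

  aboveDisjoint : ∀ {z} → Above a z → Above a' z → ⊥
  aboveDisjoint (_ , z⊏y , b , x≺b , b⊑z , conn) (_ , _ , b' , x≺b' , b'⊑z , conn') =
    disconnected (connectedSym conn ◅◅ (atomsBelowConnected z⊏y x≺b x≺b' b⊑z b'⊑z ◅◅ conn'))

  data OnSide (t z : Elt P) : Set where
    sideX  : z ≡ x → OnSide t z
    sideY  : z ≡ y → OnSide t z
    sideIn : Above t z → OnSide t z

  onSide? : ∀ t z → Dec (OnSide t z)
  onSide? t z =
    map′ (λ { (inj₁ e) → sideX e ; (inj₂ (inj₁ e)) → sideY e ; (inj₂ (inj₂ i)) → sideIn i })
         (λ { (sideX e) → inj₁ e ; (sideY e) → inj₂ (inj₁ e) ; (sideIn i) → inj₂ (inj₂ i) })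
         ((z ≟ x) ⊎-dec ((z ≟ y) ⊎-dec above? t z))

  side : Elt P → Elt P → Bool
  side t z = isYes (onSide? t z)

  onSide : ∀ {t z} → T (side t z) → OnSide t z
  onSide {t} {z} = toWitness {a? = onSide? t z}

  inSide : ∀ {t z} → OnSide t z → T (side t z)
  inSide {t} {z} = fromWitness {a? = onSide? t z}

  sideLower : ∀ {t z} → OnSide t z → x ⊑ z
  sideLower (sideX refl) = ⊑-refl
  sideLower (sideY refl) = proj₁ x⊏y
  sideLower (sideIn i) = proj₁ (x⊏above i)

  sideUpper : ∀ {t z} → OnSide t z → z ⊑ y
  sideUpper (sideX refl) = proj₁ x⊏y
  sideUpper (sideY refl) = ⊑-refl
  sideUpper (sideIn i) = proj₁ (above⊏y i)

  sideBetween : ∀ {t z w m} → OnSide t z → OnSide t w → z ⊏ m → m ⊏ w →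
                ¬ (z ≡ x × w ≡ y) → Above t m
  sideBetween (sideX refl) (sideX refl) z⊏m m⊏w _ = ⊥-elim (⊏-asym z⊏m m⊏w)
  sideBetween (sideX refl) (sideY refl) _ _ notBoth = ⊥-elim (notBoth (refl , refl))
  sideBetween (sideX refl) (sideIn i) z⊏m m⊏w _ = aboveDown i z⊏m (proj₁ m⊏w)
  sideBetween (sideY refl) w z⊏m m⊏w _ = ⊥-elim (⊏-irrefl (⊏-⊑-trans (⊏-trans z⊏m m⊏w) (sideUpper w)))
  sideBetween (sideIn i) w z⊏m m⊏w _ = aboveUp i (proj₁ z⊏m) (⊏-⊑-trans m⊏w (sideUpper w))

  module Side (t : Elt P) (x≺t : x ≺ t) (t⊏y : t ⊏ y) where
    t-above : Above t t
    t-above = ≺⇒⊏ x≺t , t⊏y , t , x≺t , ⊑-refl , ε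

    -- members with no member strictly between form a cover: unless they are
    -- x and y (where t is between), everything between them is a member
    saturated : ∀ {z w} → T (side t z) → T (side t w) → z ⊏ w →
                (∀ m → T (side t m) → z ⊏ m → m ⊏ w → ⊥) → z ≺ w
    saturated {z} {w} z∈ w∈ z⊏w gap = byCases (z ≟ x) (w ≟ y)
      where
      noGapUnlessWhole : ¬ (z ≡ x × w ≡ y) → z ≺ w
      noGapUnlessWhole notBoth = z⊏w , λ m z⊏m m⊏w →
        gap m (inSide (sideIn (sideBetween (onSide z∈) (onSide w∈) z⊏m m⊏w notBoth))) z⊏m m⊏w
      byCases : Dec (z ≡ x) → Dec (w ≡ y) → z ≺ w
      byCases (yes refl) (yes refl) = ⊥-elim (gap t (inSide (sideIn t-above)) (≺⇒⊏ x≺t) t⊏y)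
      byCases (no z≢x) _ = noGapUnlessWhole (z≢x ∘ proj₁)
      byCases (yes _) (no w≢y) = noGapUnlessWhole (w≢y ∘ proj₂)

    closed₂ : ∀ {z w m} → T (side t z) → T (side t w) → z ⊏ m → m ⊏ w →
              rk w ≡ suc (suc (rk z)) → T (side t m)
    closed₂ z∈ w∈ z⊏m m⊏w e =
      inSide (sideIn (sideBetween (onSide z∈) (onSide w∈) z⊏m m⊏w (notWhole e)))

    x∈ : T (side t x)
    x∈ = inSide (sideX refl)

    y∈ : T (side t y)
    y∈ = inSide (sideY refl)

    open InducedSubposet P (side t) public
    open Bounding (proj₁ thin) (proj₂ thin) saturated closed₂ x y x∈ y∈
      (λ z → sideLower ∘ onSide) (λ z → sideUpper ∘ onSide) public

    interiorAbove : ∀ q → T (Bounded.interior bounded q) → Above t (ι q)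
    interiorAbove q h = fromView (onSide (ι-in q)) (Equivalence.to (interior⇔ bounded q) h)
      where
      fromView : OnSide t (ι q) → q ≢ index x x∈ × q ≢ index y y∈ → Above t (ι q)
      fromView (sideX e) (q≢bot , _) = ⊥-elim (q≢bot (ι≡⇒≡index e x∈))
      fromView (sideY e) (_ , q≢top) = ⊥-elim (q≢top (ι≡⇒≡index e y∈))
      fromView (sideIn i) _ = i

    indexInterior : ∀ z (i : Above t z) → T (Bounded.interior bounded (index z (inSide (sideIn i))))
    indexInterior z i =
      Equivalence.from (interior⇔ bounded (index z z∈)) (differs x∈ (x≢above i) , differs y∈ (y≢above i))
      where
      z∈ : T (side t z)
      z∈ = inSide (sideIn i)
      differs : ∀ {m} (m∈ : T (side t m)) → z ≢ m → index z z∈ ≢ index m m∈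
      differs {m} m∈ z≢m e = z≢m (trans (sym (ι-index z z∈)) (trans (cong ι e) (ι-index m m∈)))

  module SideA = Side a x≺a a⊏y
  module SideA' = Side a' x≺a' a'⊏y

  B₁ : Bounded SideA.sub
  B₁ = SideA.bounded

  B₂ : Bounded SideA'.sub
  B₂ = SideA'.bounded

  data InPinch (z : Elt P) : Set where
    atX : z ≡ x → InPinch z
    atY : z ≡ y → InPinch z
    onA : Above a z → InPinch z
    onA' : Above a' z → InPinch z

  inPinch? : ∀ z → Dec (InPinch z)
  inPinch? z =
    map′ (λ { (inj₁ e) → atX e ; (inj₂ (inj₁ e)) → atY e
            ; (inj₂ (inj₂ (inj₁ i))) → onA i ; (inj₂ (inj₂ (inj₂ i))) → onA' i })
         (λ { (atX e) → inj₁ e ; (atY e) → inj₂ (inj₁ e)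
            ; (onA i) → inj₂ (inj₂ (inj₁ i)) ; (onA' i) → inj₂ (inj₂ (inj₂ i)) })
         ((z ≟ x) ⊎-dec ((z ≟ y) ⊎-dec (above? a z ⊎-dec above? a' z)))

  S : Elt P → Bool
  S z = isYes (inPinch? z)

  inPinch : ∀ {z} → T (S z) → InPinch z
  inPinch {z} = toWitness {a? = inPinch? z}

  inS : ∀ {z} → InPinch z → T (S z)
  inS {z} = fromWitness {a? = inPinch? z}

  pinchLower : ∀ {z} → InPinch z → x ⊑ z
  pinchLower (atX refl) = ⊑-refl
  pinchLower (atY refl) = proj₁ x⊏y
  pinchLower (onA i) = proj₁ (x⊏above i)
  pinchLower (onA' i) = proj₁ (x⊏above i)

  pinchUpper : ∀ {z} → InPinch z → z ⊑ y
  pinchUpper (atX refl) = proj₁ x⊏y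
  pinchUpper (atY refl) = ⊑-refl
  pinchUpper (onA i) = proj₁ (above⊏y i)
  pinchUpper (onA' i) = proj₁ (above⊏y i)

  pinchBetween : ∀ {z w m} → InPinch z → InPinch w → z ⊏ m → m ⊏ w →
                 ¬ (z ≡ x × w ≡ y) → InPinch m
  pinchBetween (atX refl) (atX refl) z⊏m m⊏w _ = ⊥-elim (⊏-asym z⊏m m⊏w)
  pinchBetween (atX refl) (atY refl) _ _ notBoth = ⊥-elim (notBoth (refl , refl))
  pinchBetween (atX refl) (onA j) z⊏m m⊏w _ = onA (aboveDown j z⊏m (proj₁ m⊏w))
  pinchBetween (atX refl) (onA' j) z⊏m m⊏w _ = onA' (aboveDown j z⊏m (proj₁ m⊏w))
  pinchBetween (atY refl) w z⊏m m⊏w _ = ⊥-elim (⊏-irrefl (⊏-⊑-trans (⊏-trans z⊏m m⊏w) (pinchUpper w)))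
  pinchBetween (onA i) w z⊏m m⊏w _ = onA (aboveUp i (proj₁ z⊏m) (⊏-⊑-trans m⊏w (pinchUpper w)))
  pinchBetween (onA' i) w z⊏m m⊏w _ = onA' (aboveUp i (proj₁ z⊏m) (⊏-⊑-trans m⊏w (pinchUpper w)))

  Sub : Set
  Sub = SubElt P S

  Pinch : Set
  Pinch = PinchElt B₁ B₂

  Sub-≡ : ∀ {z z' s s'} → z ≡ z' → _≡_ {A = Sub} (z , s) (z' , s')
  Sub-≡ {z} refl = cong (z ,_) (T-irrelevant _ _)

  inl-≡ : ∀ {q q' h h'} → q ≡ q' → _≡_ {A = Pinch} (inl q h) (inl q' h')
  inl-≡ {q} refl = cong (inl q) (T-irrelevant _ _)

  inr-≡ : ∀ {q q' h h'} → q ≡ q' → _≡_ {A = Pinch} (inr q h) (inr q' h')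
  inr-≡ {q} refl = cong (inr q) (T-irrelevant _ _)

  x≢y : x ≢ y
  x≢y = proj₂ x⊏y

  toPinch : ∀ z → InPinch z → Pinch
  toPinch z (atX _) = pbot
  toPinch z (atY _) = ptop
  toPinch z (onA i) = inl (SideA.index z (inSide (sideIn i))) (SideA.indexInterior z i)
  toPinch z (onA' i) = inr (SideA'.index z (inSide (sideIn i))) (SideA'.indexInterior z i)

  fromPinch : Pinch → Sub
  fromPinch pbot = x , inS (atX refl)
  fromPinch ptop = y , inS (atY refl)
  fromPinch (inl q h) = SideA.ι q , inS (onA (SideA.interiorAbove q h))
  fromPinch (inr q h) = SideA'.ι q , inS (onA' (SideA'.interiorAbove q h))

  toPinch-x : ∀ (v : InPinch x) → toPinch x v ≡ pbot
  toPinch-x (atX _) = refl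
  toPinch-x (atY e) = ⊥-elim (x≢y e)
  toPinch-x (onA i) = ⊥-elim (x≢above i refl)
  toPinch-x (onA' i) = ⊥-elim (x≢above i refl)

  toPinch-y : ∀ (v : InPinch y) → toPinch y v ≡ ptop
  toPinch-y (atX e) = ⊥-elim (x≢y (sym e))
  toPinch-y (atY _) = refl
  toPinch-y (onA i) = ⊥-elim (y≢above i refl)
  toPinch-y (onA' i) = ⊥-elim (y≢above i refl)

  toPinch-inl : ∀ q h (v : InPinch (SideA.ι q)) → toPinch (SideA.ι q) v ≡ inl q h
  toPinch-inl q h (atX e) = ⊥-elim (x≢above (SideA.interiorAbove q h) e)
  toPinch-inl q h (atY e) = ⊥-elim (y≢above (SideA.interiorAbove q h) e)
  toPinch-inl q h (onA i) = inl-≡ (Enumeration.indexOf-member (side a) q _)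
  toPinch-inl q h (onA' i) = ⊥-elim (aboveDisjoint (SideA.interiorAbove q h) i)

  toPinch-inr : ∀ q h (v : InPinch (SideA'.ι q)) → toPinch (SideA'.ι q) v ≡ inr q h
  toPinch-inr q h (atX e) = ⊥-elim (x≢above (SideA'.interiorAbove q h) e)
  toPinch-inr q h (atY e) = ⊥-elim (y≢above (SideA'.interiorAbove q h) e)
  toPinch-inr q h (onA i) = ⊥-elim (aboveDisjoint i (SideA'.interiorAbove q h))
  toPinch-inr q h (onA' i) = inr-≡ (Enumeration.indexOf-member (side a') q _)

  from-toPinch : ∀ z s (v : InPinch z) → fromPinch (toPinch z v) ≡ (z , s)
  from-toPinch z s (atX e) = Sub-≡ (sym e)
  from-toPinch z s (atY e) = Sub-≡ (sym e)
  from-toPinch z s (onA i) = Sub-≡ (SideA.ι-index z _)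
  from-toPinch z s (onA' i) = Sub-≡ (SideA'.ι-index z _)

  to : Sub → Pinch
  to (z , s) = toPinch z (inPinch s)

  to-fromPinch : ∀ w → to (fromPinch w) ≡ w
  to-fromPinch pbot = toPinch-x _
  to-fromPinch ptop = toPinch-y _
  to-fromPinch (inl q h) = toPinch-inl q h _
  to-fromPinch (inr q h) = toPinch-inr q h _

  pinchBijection : Sub ↔ Pinch
  pinchBijection = mk↔ₛ′ to fromPinch to-fromPinch (λ { (z , s) → from-toPinch z s (inPinch s) })

  toPinch-order : ∀ {z w} (v : InPinch z) (v' : InPinch w) →
                  (z ⊑ w) ⇔ _≤⋈_ B₁ B₂ (toPinch z v) (toPinch w v')
  toPinch-order (atX refl) v' = mk⇔ (λ _ → tt) (λ _ → pinchLower v')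
  toPinch-order (atY refl) (atX refl) = mk⇔ (λ y⊑x → x≢y (⊑-antisym (proj₁ x⊏y) y⊑x)) ⊥-elim
  toPinch-order (atY refl) (atY refl) = mk⇔ (λ _ → tt) (λ _ → ⊑-refl)
  toPinch-order (atY refl) (onA j) = mk⇔ (λ y⊑w → ⊏-irrefl (⊑-⊏-trans y⊑w (above⊏y j))) ⊥-elim
  toPinch-order (atY refl) (onA' j) = mk⇔ (λ y⊑w → ⊏-irrefl (⊑-⊏-trans y⊑w (above⊏y j))) ⊥-elim
  toPinch-order (onA i) (atX refl) = mk⇔ (λ z⊑x → ⊏-irrefl (⊏-⊑-trans (x⊏above i) z⊑x)) ⊥-elim
  toPinch-order (onA i) (atY refl) = mk⇔ (λ _ → tt) (λ _ → proj₁ (above⊏y i))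
  toPinch-order (onA i) (onA j) = mk⇔ (subst₂ _⊑_ (sym (SideA.ι-index _ _)) (sym (SideA.ι-index _ _)))
                                      (subst₂ _⊑_ (SideA.ι-index _ _) (SideA.ι-index _ _))
  toPinch-order (onA i) (onA' j) = mk⇔ (λ z⊑w → aboveDisjoint (aboveUp i z⊑w (above⊏y j)) j) ⊥-elim
  toPinch-order (onA' i) (atX refl) = mk⇔ (λ z⊑x → ⊏-irrefl (⊏-⊑-trans (x⊏above i) z⊑x)) ⊥-elim
  toPinch-order (onA' i) (atY refl) = mk⇔ (λ _ → tt) (λ _ → proj₁ (above⊏y i))
  toPinch-order (onA' i) (onA j) = mk⇔ (λ z⊑w → aboveDisjoint j (aboveUp i z⊑w (above⊏y j))) ⊥-elim
  toPinch-order (onA' i) (onA' j) = mk⇔ (subst₂ _⊑_ (sym (SideA'.ι-index _ _)) (sym (SideA'.ι-index _ _)))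
                                        (subst₂ _⊑_ (SideA'.ι-index _ _) (SideA'.ι-index _ _))

  pinchIso : OrderIso (_≤S_ P S) (_≤⋈_ B₁ B₂)
  pinchIso = pinchBijection , λ { (z , s) (w , s') → toPinch-order (inPinch s) (inPinch s') }

  pinchSaturated : Saturated P S
  pinchSaturated (z , s) (w , s') ((z⊑w , z≢w) , gap) = byCases (z ≟ x) (w ≟ y)
    where
    noGapUnlessWhole : ¬ (z ≡ x × w ≡ y) → z ≺ w
    noGapUnlessWhole notBoth = (z⊑w , z≢w ∘ Sub-≡) , λ m z⊏m m⊏w →
      gap (m , inS (pinchBetween (inPinch s) (inPinch s') z⊏m m⊏w notBoth))
          (proj₁ z⊏m , proj₂ z⊏m ∘ cong proj₁) (proj₁ m⊏w , proj₂ m⊏w ∘ cong proj₁)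
    byCases : Dec (z ≡ x) → Dec (w ≡ y) → z ≺ w
    byCases (yes refl) (yes refl) =
      ⊥-elim (gap (a , inS (onA SideA.t-above))
                  (proj₁ (≺⇒⊏ x≺a) , proj₂ (≺⇒⊏ x≺a) ∘ cong proj₁)
                  (a⊑y , proj₂ a⊏y ∘ cong proj₁))
    byCases (no z≢x) _ = noGapUnlessWhole (z≢x ∘ proj₁)
    byCases (yes _) (no w≢y) = noGapUnlessWhole (w≢y ∘ proj₂)

  -- S is diamond complete: a diamond move inside [x , y] on a chain of S
  -- replaces a middle element of a length-2 interval, which lies in S
  pinchDiamondComplete : DiamondComplete P S
  pinchDiamondComplete C _ _
    (L , R , x' , _ , b , y' , (_ , x'≺a₀ , a₀≺y' , x'≺b , b≺y' , _) , e , refl) =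
    replaceMiddle (++⁻ L (subst (All (T ∘ S)) e (map⁺ (universal proj₂ C))))
    where
    replaceMiddle : All (T ∘ S) L × All (T ∘ S) (x' ∷ _ ∷ y' ∷ R) →
                    All (T ∘ S) (L ++ x' ∷ b ∷ y' ∷ R)
    replaceMiddle (inL , (x'∈ ∷ _ ∷ y'∈ ∷ inR)) = ++⁺ inL (x'∈ ∷ b∈ ∷ y'∈ ∷ inR)
      where
      b∈ : T (S b)
      b∈ = inS (pinchBetween (inPinch x'∈) (inPinch y'∈) (≺⇒⊏ x'≺b) (≺⇒⊏ b≺y')
                             (notWhole (rankOfTwoCovers x'≺a₀ a₀≺y')))

  pinch : ContainsPinch P
  pinch = SideA.sub , SideA'.sub , B₁ , B₂ , rk y ∸ rk x , SideA.boundedRank , SideA'.boundedRank ,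
          length≥3 , S , pinchSaturated , pinchDiamondComplete , pinchIso

module TransitivityWithoutPinch (P : FinPoset) (thin : IsThin P) (noPinch : ¬ ContainsPinch P) where
  open ThinPoset P thin

  shorterBelow : ∀ {x z y C D} → z ⊏ y → SatChain P x z C → SatChain P x y D → length C < length D
  shorterBelow {x} z⊏y c d =
    +-cancelˡ-< (rk x) _ _ (subst₂ _<_ (sym (rankChain c)) (sym (rankChain d)) (s≤s (rk-strict z⊏y)))

  ConnectedUpTo : ℕ → Set
  ConnectedUpTo k = ∀ {x y C D} → length C ≤ k → SatChain P x y C → SatChain P x y D → Star Move C D

  -- chains through connected atoms are connected: walk along the path in the
  -- atom graph, crossing each edge by one diamond move
  alongPath : ∀ {k} → ConnectedUpTo k → ∀ {x y b c D D'} → length D ≤ k →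
              AtomGraph.Connected x y b c → _⋖_ P x b → _⋖_ P x c →
              SatChain P b y D → SatChain P c y D' → Star Move (x ∷ D) (x ∷ D')
  alongPath connect short ε x≺b x≺c chain chain' = consMoves _ (connect short chain chain')
  alongPath {k} connect {x} {y} {b} short
    ((w , diamond@(_ , _ , b≺w , x≺m , m≺w , _) , w⊑y) ◅ path) x≺b x≺c chain chain'
    with satChainExists w⊑y
  ... | F , chainF with satChainShape chainF
  ...   | F' , refl =
    consMoves x (connect short chain viaB) ◅◅ (cross ◅ alongPath connect short' path x≺m x≺c viaM chain')
    where
    viaB : SatChain P b y (b ∷ w ∷ F')
    viaB = step b≺w chainF
    viaM : SatChain P _ y (_ ∷ w ∷ F')
    viaM = step m≺w chainF
    short' : length (b ∷ w ∷ F') ≤ k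
    short' = subst (_≤ k) (chainLengthUnique chain viaB) short
    cross : Move (x ∷ _ ∷ w ∷ F') (x ∷ _ ∷ w ∷ F')
    cross = [] , F' , x , _ , _ , w , diamond , refl , refl

  -- two chains from x to y either start with connected atoms, or their atoms
  -- are disconnected and span a pinch (using the induction hypothesis below y)
  connectChains : ∀ k → ConnectedUpTo k
  connectChains k short (single x) (single .x) = ε
  connectChains k short (single x) (step x≺z chain) = ⊥-elim (noReturn x≺z chain)
  connectChains k short (step x≺z chain) (single _) = ⊥-elim (noReturn x≺z chain)
  connectChains (suc k) (s≤s short) (step {x} {a} {y} x≺a chainA) (step {z = a'} x≺a' chainA')
    with AtomGraph.connected? x y a a'
  ... | yes path = alongPath (connectChains k) short path x≺a x≺a' chainA chainA'
  ... | no disconnected = ⊥-elim (noPinch (PinchOfDisconnectedAtoms.pinch P thin x y a a' x≺a x≺a'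
                                    (satChain⇒⊑ chainA) (satChain⇒⊑ chainA') disconnected transitiveBelow))
    where
    transitiveBelow : ∀ {z C D} → z ⊏ y → SatChain P x z C → SatChain P x z D → Star Move C D
    transitiveBelow z⊏y c =
      connectChains k (≤-pred (≤-trans (shorterBelow z⊏y c (step x≺a chainA)) (s≤s short))) c

  diamondTransitive : DiamondTransitive P
  diamondTransitive x y _ C C' chain chain' = connectChains (length C) ≤-refl chain chain'

_∘-iso_ : ∀ {A B C : Set} {_≤A_ : A → A → Set} {_≤B_ : B → B → Set} {_≤C_ : C → C → Set} →
          OrderIso _≤B_ _≤C_ → OrderIso _≤A_ _≤B_ → OrderIso _≤A_ _≤C_
(ψ , ψ-order) ∘-iso (φ , φ-order) =
  ψ ↔-∘ φ , λ u v → ψ-order (Inverse.to φ u) (Inverse.to φ v) ⇔-∘ φ-order u v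

module _ {Q₁ Q₂ : FinPoset} (B₁ : Bounded Q₁) (B₂ : Bounded Q₂) where
  swapSides : PinchElt B₁ B₂ → PinchElt B₂ B₁
  swapSides pbot = pbot
  swapSides ptop = ptop
  swapSides (inl q h) = inr q h
  swapSides (inr q h) = inl q h

  swapSides-order : ∀ u v → _≤⋈_ B₁ B₂ u v ⇔ _≤⋈_ B₂ B₁ (swapSides u) (swapSides v)
  swapSides-order pbot v = mk⇔ id id
  swapSides-order ptop pbot = mk⇔ id id
  swapSides-order ptop ptop = mk⇔ id id
  swapSides-order ptop (inl _ _) = mk⇔ id id
  swapSides-order ptop (inr _ _) = mk⇔ id id
  swapSides-order (inl _ _) pbot = mk⇔ id id
  swapSides-order (inl _ _) ptop = mk⇔ id id
  swapSides-order (inl _ _) (inl _ _) = mk⇔ id id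
  swapSides-order (inl _ _) (inr _ _) = mk⇔ id id
  swapSides-order (inr _ _) pbot = mk⇔ id id
  swapSides-order (inr _ _) ptop = mk⇔ id id
  swapSides-order (inr _ _) (inl _ _) = mk⇔ id id
  swapSides-order (inr _ _) (inr _ _) = mk⇔ id id

swapIso : ∀ {Q₁ Q₂} (B₁ : Bounded Q₁) (B₂ : Bounded Q₂) → OrderIso (_≤⋈_ B₁ B₂) (_≤⋈_ B₂ B₁)
swapIso B₁ B₂ =
  mk↔ₛ′ (swapSides B₁ B₂) (swapSides B₂ B₁) involution involution , swapSides-order B₁ B₂
  where
  involution : ∀ {Q₁ Q₂} {C₁ : Bounded Q₁} {C₂ : Bounded Q₂} w →
               swapSides C₁ C₂ (swapSides C₂ C₁ w) ≡ w
  involution pbot = refl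
  involution ptop = refl
  involution (inl _ _) = refl
  involution (inr _ _) = refl

module PinchEmbedding (P : FinPoset) {Q₁ Q₂ : FinPoset} (B₁ : Bounded Q₁) (B₂ : Bounded Q₂)
  (S : Elt P → Bool) (saturated : Saturated P S) (iso : OrderIso (_≤S_ P S) (_≤⋈_ B₁ B₂)) where
  open FinitePoset P

  Sub : Set
  Sub = SubElt P S

  Pinch : Set
  Pinch = PinchElt B₁ B₂

  _≼_ : Pinch → Pinch → Set
  _≼_ = _≤⋈_ B₁ B₂

  to : Sub → Pinch
  to = Inverse.to (proj₁ iso)

  from : Pinch → Sub
  from = Inverse.from (proj₁ iso)

  to-from : ∀ w → to (from w) ≡ w
  to-from w = Inverse.inverseˡ (proj₁ iso) refl

  from-to : ∀ u → from (to u) ≡ u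
  from-to u = Inverse.inverseʳ (proj₁ iso) refl

  ≼⇒⊑ : ∀ {u v} → to u ≼ to v → proj₁ u ⊑ proj₁ v
  ≼⇒⊑ {u} {v} = Equivalence.from (proj₂ iso u v)

  ⊑⇒≼ : ∀ {u v} → proj₁ u ⊑ proj₁ v → to u ≼ to v
  ⊑⇒≼ {u} {v} = Equivalence.to (proj₂ iso u v)

  Sub-≡ : ∀ {z z' s s'} → z ≡ z' → _≡_ {A = Sub} (z , s) (z' , s')
  Sub-≡ {z} refl = cong (z ,_) (T-irrelevant _ _)

  at : Pinch → Elt P
  at w = proj₁ (from w)

  at-injective : ∀ {w w'} → at w ≡ at w' → w ≡ w'
  at-injective {w} {w'} e = trans (sym (to-from w)) (trans (cong to (Sub-≡ e)) (to-from w'))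

  X Y : Elt P
  X = at pbot
  Y = at ptop

  ≼-at : ∀ {w w'} → w ≼ w' → at w ⊑ at w'
  ≼-at {w} {w'} w≼w' = ≼⇒⊑ (subst₂ _≼_ (sym (to-from w)) (sym (to-from w')) w≼w')

  belowY : ∀ u → proj₁ u ⊑ Y
  belowY u = ≼⇒⊑ (subst (to u ≼_) (sym (to-from ptop)) (≼ptop (to u)))
    where
    ≼ptop : ∀ w → w ≼ ptop
    ≼ptop pbot = tt
    ≼ptop ptop = tt
    ≼ptop (inl _ _) = tt
    ≼ptop (inr _ _) = tt

  coverInP : ∀ {w w'} → Cover _≼_ w w' → at w ≺ at w'
  coverInP {w} {w'} ((w≼w' , w≢w') , gap) = saturated (from w) (from w') subCover
    where
    subCover : Cover (_≤S_ P S) (from w) (from w')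
    subCover = (≼-at w≼w' , λ e → w≢w' (trans (sym (to-from w)) (trans (cong to e) (to-from w')))) ,
      λ r (w⊑r , w≢r) (r⊑w' , r≢w') →
        gap (to r)
            (subst (_≼ to r) (to-from w) (⊑⇒≼ w⊑r) , λ e → w≢r (trans (cong from e) (from-to r)))
            (subst (to r ≼_) (to-from w') (⊑⇒≼ r⊑w') , λ e → r≢w' (trans (sym (from-to r)) (cong from e)))

  module Q₁ = FinitePoset Q₁

  bot₁ top₁ : Elt Q₁
  bot₁ = Bounded.bot B₁
  top₁ = Bounded.top B₁

  Interior₁ : Elt Q₁ → Set
  Interior₁ q = T (Bounded.interior B₁ q)

  interior₁ : ∀ {q} → q ≢ bot₁ → q ≢ top₁ → Interior₁ q
  interior₁ q≢bot q≢top = Equivalence.from (interior⇔ B₁ _) (q≢bot , q≢top)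

  notTop₁ : ∀ {q} → Interior₁ q → q ≢ top₁
  notTop₁ {q} = proj₂ ∘ Equivalence.to (interior⇔ B₁ q)

  inl-≡ : ∀ {q q' h h'} → q ≡ q' → _≡_ {A = Pinch} (inl q h) (inl q' h')
  inl-≡ {q} refl = cong (inl q) (T-irrelevant _ _)

  leftCover : ∀ {p q hp hq} → _⋖_ Q₁ p q → Cover _≼_ (inl p hp) (inl q hq)
  leftCover ((p⊑q , p≢q) , gap) = (p⊑q , λ { refl → p≢q refl }) , noneBetween
    where
    noneBetween : ∀ r → Strict _≼_ (inl _ _) r → Strict _≼_ r (inl _ _) → ⊥
    noneBetween (inl r _) (p⊑r , p≢r) (r⊑q , r≢q) = gap r (p⊑r , p≢r ∘ inl-≡) (r⊑q , r≢q ∘ inl-≡)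

  bottomCover : ∀ {q hq} → _⋖_ Q₁ bot₁ q → Cover _≼_ pbot (inl q hq)
  bottomCover (_ , gap) = (tt , λ ()) , noneBetween
    where
    noneBetween : ∀ r → Strict _≼_ pbot r → Strict _≼_ r (inl _ _) → ⊥
    noneBetween pbot (_ , ≢) _ = ≢ refl
    noneBetween (inl r hr) _ (r⊑q , r≢q) =
      gap r (Bounded.isMin B₁ r , proj₁ (Equivalence.to (interior⇔ B₁ r) hr) ∘ sym) (r⊑q , r≢q ∘ inl-≡)

  topCover : ∀ {p hp} → _⋖_ Q₁ p top₁ → Cover _≼_ (inl p hp) ptop
  topCover (_ , gap) = (tt , λ ()) , noneBetween
    where
    noneBetween : ∀ r → Strict _≼_ (inl _ _) r → Strict _≼_ r ptop → ⊥
    noneBetween ptop _ (_ , ≢) = ≢ refl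
    noneBetween (inl r hr) (p⊑r , p≢r) _ =
      gap r (p⊑r , p≢r ∘ inl-≡) (Bounded.isMax B₁ r , proj₂ (Equivalence.to (interior⇔ B₁ r) hr))

  IsLeft : Pinch → Set
  IsLeft (inl _ _) = ⊤
  IsLeft _ = ⊥

  OnLeft : Elt P → Set
  OnLeft z = z ≡ X ⊎ z ≡ Y ⊎ Σ[ s ∈ T (S z) ] IsLeft (to (z , s))

  atLeft : ∀ q h → OnLeft (at (inl q h))
  atLeft q h = inj₂ (inj₂ (proj₂ (from (inl q h)) , subst IsLeft (sym (to-from (inl q h))) tt))

  leftChain : ∀ {u C} (hu : Interior₁ u) → SatChain Q₁ u top₁ C →
              Σ[ L ∈ List (Elt P) ] (SatChain P (at (inl u hu)) Y (at (inl u hu) ∷ L) ×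
                                     All OnLeft (at (inl u hu) ∷ L) × length (at (inl u hu) ∷ L) ≡ length C)
  leftChain hu (single _) = ⊥-elim (notTop₁ hu refl)
  leftChain {u} hu (step {z = v} u≺v chain) with v ≟ top₁
  ... | yes refl = Y ∷ [] , step (coverInP (topCover u≺v)) (single Y) ,
                   atLeft u hu ∷ inj₂ (inj₁ refl) ∷ [] , cong suc (sym (Q₁.satChainLoop chain))
  ... | no v≢top with leftChain hv chain
    where
    hv : Interior₁ v
    hv = interior₁ (λ { refl → proj₁ (Equivalence.to (interior⇔ B₁ u) hu)
                                 (Q₁.⊑-antisym (Q₁.≺⇒⊑ u≺v) (Bounded.isMin B₁ u)) }) v≢top
  ...   | L , chainL , onL , len =
    at (inl v _) ∷ L , step (coverInP (leftCover u≺v)) chainL , atLeft u hu ∷ onL , cong suc len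

  fullLeftChain : 3 ≤ Bounded.rank B₁ →
    Σ[ q ∈ Elt Q₁ ] Σ[ h ∈ Interior₁ q ] Σ[ L ∈ List (Elt P) ]
      (SatChain P X Y (X ∷ at (inl q h) ∷ L) × All OnLeft (X ∷ at (inl q h) ∷ L) ×
       4 ≤ length (X ∷ at (inl q h) ∷ L))
  fullLeftChain long with Q₁.satChainExists (Bounded.isMin B₁ top₁)
  ... | _ , chain with chain | maximalChainLong B₁ long chain
  ...   | single _ | s≤s ()
  ...   | step {z = q} bot≺q rest | four with q ≟ top₁
  ...     | yes refl = ⊥-elim (tooShort (subst (4 ≤_) (cong suc (Q₁.satChainLoop rest)) four))
    where
    tooShort : ¬ (4 ≤ 2)
    tooShort (s≤s (s≤s ()))
  ...     | no q≢top with leftChain hq rest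
    where
    hq : Interior₁ q
    hq = interior₁ (proj₂ (Q₁.≺⇒⊏ bot≺q) ∘ sym) q≢top
  ...       | L , chainL , onL , len =
    q , _ , L , step (coverInP (bottomCover bot≺q)) chainL , inj₁ refl ∷ onL ,
    subst (4 ≤_) (cong suc (sym len)) four

  rightNotOnLeft : ∀ q h → ¬ OnLeft (at (inr q h))
  rightNotOnLeft q h (inj₁ e) with at-injective {inr q h} {pbot} e
  ... | ()
  rightNotOnLeft q h (inj₂ (inj₁ e)) with at-injective {inr q h} {ptop} e
  ... | ()
  rightNotOnLeft q h (inj₂ (inj₂ (s , left))) =
    subst IsLeft (trans (cong to (Sub-≡ refl)) (to-from (inr q h))) left

  leftNotBelowRight : ∀ w {q h} → IsLeft w → ¬ (w ≼ inr q h)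
  leftNotBelowRight (inl _ _) _ ()

  rightNotBelowLeft : ∀ w {q h} → IsLeft w → ¬ (inr q h ≼ w)
  rightNotBelowLeft (inl _ _) _ ()

  module StayingLeft (thin : IsThin P) (complete : DiamondComplete P S) (long : 3 ≤ Bounded.rank B₁) where
    open Ranks (proj₁ thin)
    open ThinPoset P thin using (moveSatChain)

    XY-long : 3 + rk X ≤ rk Y
    XY-long with fullLeftChain long
    ... | _ , _ , _ , chain , _ , four =
      ≤-pred (subst (_≤ suc (rk Y)) (+-comm (rk X) 4)
               (subst (rk X + 4 ≤_) (rankChain chain) (+-monoʳ-≤ (rk X) four)))

    inS : ∀ {z} → OnLeft z → T (S z)
    inS (inj₁ refl) = proj₂ (from pbot)
    inS (inj₂ (inj₁ refl)) = proj₂ (from ptop)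
    inS (inj₂ (inj₂ (s , _))) = s

    coverInSub : ∀ {z w} s s' → z ≺ w → Cover (_≤S_ P S) (z , s) (w , s')
    coverInSub s s' ((z⊑w , z≢w) , gap) = (z⊑w , z≢w ∘ cong proj₁) ,
      λ r (z⊑r , z≢r) (r⊑w , r≢w) → gap (proj₁ r) (z⊑r , z≢r ∘ Sub-≡) (r⊑w , r≢w ∘ Sub-≡)

    liftChain : ∀ {s t C} → SatChain P s t C → All (T ∘ S) C →
      Σ[ s∈ ∈ T (S s) ] Σ[ Cs ∈ List Sub ]
        (map proj₁ ((s , s∈) ∷ Cs) ≡ C × Linked (Cover (_≤S_ P S)) ((s , s∈) ∷ Cs))
    liftChain (single _) (s∈ ∷ []) = s∈ , [] , refl , [-]
    liftChain (step c chain) (s∈ ∷ rest) with liftChain chain rest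
    ... | z∈ , Cs , e , linked = s∈ , _ ∷ Cs , cong (_ ∷_) e , coverInSub s∈ z∈ c ∷ linked

    middleOnLeft : ∀ {x' b y'} → x' ≺ b → b ≺ y' → OnLeft x' → OnLeft y' → T (S b) → OnLeft b
    middleOnLeft {x'} {b} {y'} x'≺b b≺y' onX onY s = byPosition (to (b , s)) refl
      where
      atPosition : ∀ {w} → to (b , s) ≡ w → b ≡ at w
      atPosition e = cong proj₁ (trans (sym (from-to (b , s))) (cong from e))
      byPosition : ∀ w → to (b , s) ≡ w → OnLeft b
      byPosition pbot e = inj₁ (atPosition e)
      byPosition ptop e = inj₂ (inj₁ (atPosition e))
      byPosition (inl _ _) e = inj₂ (inj₂ (s , subst IsLeft (sym e) tt))
      byPosition (inr q h) e = ⊥-elim (notOnRight onX onY)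
        where
        notOnRight : OnLeft x' → OnLeft y' → ⊥
        notOnRight (inj₂ (inj₂ (s' , left))) _ =
          leftNotBelowRight (to (x' , s')) left (subst (to (x' , s') ≼_) e (⊑⇒≼ (≺⇒⊑ x'≺b)))
        notOnRight (inj₂ (inj₁ refl)) _ = ⊏-irrefl (⊏-⊑-trans (≺⇒⊏ x'≺b) (belowY (b , s)))
        notOnRight (inj₁ refl) (inj₂ (inj₂ (s' , left))) =
          rightNotBelowLeft (to (y' , s')) left (subst (_≼ to (y' , s')) e (⊑⇒≼ (≺⇒⊑ b≺y')))
        notOnRight (inj₁ refl) (inj₁ refl) = ⊏-asym (≺⇒⊏ x'≺b) (≺⇒⊏ b≺y')
        notOnRight (inj₁ refl) (inj₂ (inj₁ refl)) =
          1+n≰n (subst (3 + rk X ≤_) (rankOfTwoCovers x'≺b b≺y') XY-long)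

    -- the element inserted by a diamond move lies in S by diamond completeness,
    -- hence on the left
    moveStaysLeft : ∀ {C D} → SatChain P X Y C → All OnLeft C → DiamondMove P C D → All OnLeft D
    moveStaysLeft chain onC
      (L , R , x' , a₀ , b , y' , diamond@(_ , _ , _ , x'≺b , b≺y' , _) , refl , refl)
      with ++⁻ L onC
    ... | onL , (onX ∷ _ ∷ onY ∷ onR) = ++⁺ onL (onX ∷ middleOnLeft x'≺b b≺y' onX onY b∈S ∷ onY ∷ onR)
      where
      b∈S : T (S b)
      b∈S with liftChain chain (All.map inS onC)
      ... | _ , Cs , e , linked
        with ++⁻ʳ L (complete (_ ∷ Cs) linked _ (L , R , x' , a₀ , b , y' , diamond , e , refl))
      ...   | _ ∷ b∈ ∷ _ = b∈

    movesStayLeft : ∀ {C D} → SatChain P X Y C → All OnLeft C → Star (DiamondMove P) C D → All OnLeft D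
    movesStayLeft chain onC ε = onC
    movesStayLeft chain onC (m ◅ ms) = movesStayLeft (moveSatChain chain m) (moveStaysLeft chain onC m) ms

-- Chains through the left and through the right side of an embedded
-- diamond-complete pinch are never connected by diamond moves: the moves never
-- leave the left side.
module TwoSides (P : FinPoset) (thin : IsThin P) {Q₁ Q₂ : FinPoset} (B₁ : Bounded Q₁) (B₂ : Bounded Q₂)
  (S : Elt P → Bool) (saturated : Saturated P S) (complete : DiamondComplete P S)
  (iso : OrderIso (_≤S_ P S) (_≤⋈_ B₁ B₂))
  (long₁ : 3 ≤ Bounded.rank B₁) (long₂ : 3 ≤ Bounded.rank B₂) where
  module Left = PinchEmbedding P B₁ B₂ S saturated iso
  module Right = PinchEmbedding P B₂ B₁ S saturated (_∘-iso_ {_≤C_ = _≤⋈_ B₂ B₁} (swapIso B₁ B₂) iso)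

  notTransitive : ¬ DiamondTransitive P
  notTransitive transitive with Left.fullLeftChain long₁ | Right.fullLeftChain long₂
  ... | _ , _ , _ , leftChain , onLeft , _ | q , h , _ , rightChain , _ , _
    with Left.StayingLeft.movesStayLeft thin complete long₁ leftChain onLeft
           (transitive _ _ (FinitePoset.satChain⇒⊑ P leftChain) _ _ leftChain rightChain)
  ... | _ ∷ rightOnLeft ∷ _ = Left.rightNotOnLeft q h rightOnLeft

noPinchIfTransitive : ∀ P → IsThin P → DiamondTransitive P → ¬ ContainsPinch P
noPinchIfTransitive P thin transitive
  (_ , _ , B₁ , B₂ , n , rank₁ , rank₂ , n≥3 , S , saturated , complete , iso) =
  TwoSides.notTransitive P thin B₁ B₂ S saturated complete iso
    (subst (3 ≤_) (sym rank₁) n≥3) (subst (3 ≤_) (sym rank₂) n≥3) transitive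

mainTheorem5 : (P : FinPoset) → IsThin P →
    DiamondTransitive P ⇔ (¬ ContainsPinch P)
mainTheorem5 P thin =
  mk⇔ (noPinchIfTransitive P thin) (TransitivityWithoutPinch.diamondTransitive P thin)
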